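{- Let $n\ge1$ and $1\le k\le n$. For each $w\in\mathcal A(n,k)$ the word $\alpha(w)$ lies in $\mathcal R(n,k)$ and $w\le\alpha(w)$ in $\Pi(n,k)$, and $\Pi(n,k)$ is the disjoint union of the intervals $$\Pi(n,k)=\bigsqcup_{w\in\mathcal A(n,k)}[w,\alpha(w)].$$ Moreover, if $w\in\mathcal A(n,k)$ satisfies $q^{A(w)}(1+q)^{B(w)}=q^i(1+q)^j$, then $w$ has rank $i$ in $\Pi(n,k)$ and the interval $[w,\alpha(w)]$ is isomorphic to the Boolean algebra of all subsets of a $j$-element set.
   Context: An RG-word of length $n$ with maximum letter $k$ is a word $w=w_1\cdots w_n$ of positive integers with $w_1=1$, $w_i\le\max(w_1,\dots,w_{i-1})+1$ for $2\le i\le n$, and $\max_i w_i=k$; $\mathcal R(n,k)$ denotes their set. $w$ is allowable if every even letter of $w$ occurs exactly once; $\mathcal A(n,k)\subseteq\mathcal R(n,k)$ is the set of allowable words. With $m_i=\max(w_1,\dots,w_i)$, let $A(w)=\sum_{i=2}^n A_i(w)$, $B(w)=\sum_{i=2}^nB_i(w)$ where $A_i(w)=w_i-1$ if $m_{i-1}\ge w_i$ and $0$ otherwise, and $B_i(w)=1$ if $m_{i-1}>w_i$ and $0$ otherwise. The Stirling poset of the second kind $\Pi(n,k)$ is the partial order on $\mathcal R(n,k)$ generated by the cover relations $v\lessdot w$ whenever $w$ is obtained from $v$ by increasing exactly one entry by $1$. It is graded, the rank of $w$ being $\sum_{i=1}^n w_i-n-\binom{k}{2}$. For $w\in\mathcal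 A(n,k)$ let $\mathrm{Inv}(w)=\{i: w_j>w_i\text{ for some } j<i\}$, and let $\alpha(w)$ be the word obtained from $w$ by adding $1$ to each entry $w_i$ with $i\in\mathrm{Inv}(w)$. -}

module Defs where

open import Data.Nat using (ℕ; zero; suc; _+_; _∸_; _≤_; _<_; _⊔_; _≤ᵇ_; _<ᵇ_; _≟_)
open import Data.Nat.Divisibility using (_∣_)
open import Data.Nat.Combinatorics using (_C_)
open import Data.Bool using (if_then_else_)
open import Data.Fin using (Fin)
open import Data.Fin.Subset using (Subset; _⊆_)
open import Data.Vec using (Vec; []; _∷_; lookup; _[_]≔_; count; foldr)
open import Data.Vec.Membership.Propositional using (_∈_)
open import Data.Product using (Σ; _×_; ∃)
open import Data.Unit using (⊤)
open import Data.Empty using (⊥)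
open import Relation.Binary.PropositionalEquality using (_≡_)
open import Relation.Binary.Construct.Closure.ReflexiveTransitive using (Star)
open import Function.Bundles using (_⇔_)

Word : ℕ → Set
Word n = Vec ℕ n

maxLetter : ∀ {n} → Word n → ℕ
maxLetter = foldr _ _⊔_ 0

RGtail : ∀ {n} → ℕ → Word n → Set
RGtail m [] = ⊤
RGtail m (x ∷ xs) = (1 ≤ x) × (x ≤ suc m) × RGtail (m ⊔ x) xs

IsRG : ∀ {n} → Word n → Set
IsRG [] = ⊥
IsRG (x ∷ xs) = (x ≡ 1) × RGtail x xs

InR : (n k : ℕ) → Word n → Set
InR n k w = IsRG w × (maxLetter w ≡ k)

InA : (n k : ℕ) → Word n → Set
InA n k w = InR n k w × (∀ a → 2 ∣ a → a ∈ w → count (_≟ a) w ≡ 1)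

-- A(w) and B(w); the auxiliary argument is m_{i-1}
Atail : ∀ {n} → ℕ → Word n → ℕ
Atail m [] = 0
Atail m (x ∷ xs) = (if x ≤ᵇ m then x ∸ 1 else 0) + Atail (m ⊔ x) xs

Btail : ∀ {n} → ℕ → Word n → ℕ
Btail m [] = 0
Btail m (x ∷ xs) = (if x <ᵇ m then 1 else 0) + Btail (m ⊔ x) xs

Astat : ∀ {n} → Word n → ℕ
Astat [] = 0
Astat (x ∷ xs) = Atail x xs

Bstat : ∀ {n} → Word n → ℕ
Bstat [] = 0
Bstat (x ∷ xs) = Btail x xs

-- α(w): add 1 to every entry at a position in Inv(w), i.e. whose letter
-- is smaller than some earlier letter (equivalently, than m_{i-1}).
αtail : ∀ {n} → ℕ → Word n → Word n
αtail m [] = []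
αtail m (x ∷ xs) = (if x <ᵇ m then suc x else x) ∷ αtail (m ⊔ x) xs

α : ∀ {n} → Word n → Word n
α [] = []
α (x ∷ xs) = x ∷ αtail x xs

Cover : (n k : ℕ) → Word n → Word n → Set
Cover n k v w = InR n k v × InR n k w × Σ (Fin n) (λ i → w ≡ (v [ i ]≔ suc (lookup v i)))

Le : (n k : ℕ) → Word n → Word n → Set
Le n k = Star (Cover n k)

sumW : ∀ {n} → Word n → ℕ
sumW = foldr _ _+_ 0

rank : (n k : ℕ) → Word n → ℕ
rank n k w = sumW w ∸ n ∸ (k C 2)

InInterval : (n k : ℕ) → Word n → Word n → Set
InInterval n k w u = InR n k u × Le n k w u × Le n k u (α w)

-- The interval [w, v] of Π(n,k) is isomorphic (as a poset) to the Boolean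
-- algebra of subsets of a j-element set: an order embedding f from
-- (Subset j, ⊆) onto the interval.
BooleanInterval : (n k : ℕ) → Word n → Word n → ℕ → Set
BooleanInterval n k w v j =
  Σ (Subset j → Word n) λ f →
    (∀ S → InR n k (f S) × Le n k w (f S) × Le n k (f S) v)
  × (∀ u → InR n k u → Le n k w u → Le n k u v → ∃ λ S → f S ≡ u)
  × (∀ S T → f S ≡ f T → S ≡ T)
  × (∀ S T → (Le n k (f S) (f T) ⇔ (S ⊆ T)))

-- coefficient of q^m in the polynomial q^i (1+q)^j
qcoeff : ℕ → ℕ → ℕ → ℕ
qcoeff i j m = if m <ᵇ i then 0 else j C (m ∸ i)

-- An RG word splits into records (letters exceeding every earlier letter,
-- necessarily 1, 2, …, k in order) and non-records. Since every value below
-- the running maximum has already occurred, w is allowable exactly when all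
-- its non-record letters are odd. Raising any set of inversion letters
-- (non-records strictly below the running maximum) by one keeps all running
-- maxima, so the words between w and α(w) are exactly these raisings, and
-- subsets of the B(w) inversion positions parametrise [w, α(w)] as a Boolean
-- lattice. Conversely u ∈ R(n,k) lies in [w, α(w)] for exactly one allowable
-- w, namely u with every even non-record letter lowered by one. The records
-- contribute 1 + ⋯ + k to Σ wᵢ and a non-record wᵢ contributes 1 + Aᵢ(w), so
-- the rank of w is A(w); and q^a (1+q)^b determines a (the lowest degree)
-- and then b (the degree is a + b).

module Submission where

open import Defs
open import Data.Nat
  using (ℕ; zero; suc; pred; parity; _+_; _∸_; _≤_; _<_; _⊔_; _≤ᵇ_; _<ᵇ_; _≡ᵇ_; _≟_; _≤?_; z≤n; s≤s)
open import Data.Nat.Properties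
open import Data.Nat.Combinatorics using (_C_; nC1≡n; nCn≡1; nCk+nC[k+1]≡[n+1]C[k+1]; k>n⇒nCk≡0)
open import Algebra.Properties.CommutativeSemigroup +-commutativeSemigroup
  using (xy∙z≈y∙xz; x∙yz≈y∙xz)
open import Data.Nat.Divisibility using (_∣_; divides; ∣-refl; ∣m∣n⇒∣m+n; ∣1⇒≡1)
open import Data.Parity.Base using (0ℙ; 1ℙ; _⁻¹)
open import Data.Parity.Properties as ℙ using (suc-homo-⁻¹; ⁻¹-selfInverse; *-homo-*)
open import Data.Bool using (Bool; true; false; if_then_else_)
open import Data.Fin using (Fin; zero; suc)
open import Data.Fin.Subset using (Subset; _⊆_; ⊥; ⊤; inside; outside)
open import Data.Fin.Subset.Properties using (⊥⊆; ⊆⊤; ⊆-antisym; drop-∷-⊆)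
open import Data.Vec using ([]; _∷_; lookup; _[_]≔_; count; here; there)
open import Data.Vec.Membership.Propositional using (_∈_)
open import Data.Vec.Relation.Unary.Any using (here; there)
open import Data.Vec.Relation.Binary.Pointwise.Inductive as Pointwise using (Pointwise; []; _∷_)
open import Data.Product using (Σ; _×_; ∃; _,_; proj₁; proj₂)
open import Data.Unit as Unit using (tt)
open import Relation.Nullary using (yes; no; contradiction)
open import Relation.Nullary.Reflects using (Reflects; ofʸ; ofⁿ; fromEquivalence)
open import Relation.Binary.PropositionalEquality
open import Relation.Binary.Definitions using (tri<; tri≈; tri>)
open import Relation.Binary.Construct.Closure.ReflexiveTransitive
  using (Star; ε; _◅_; _◅◅_; gmap; fold)
open import Function.Base using (id; _∘_; _on_)
open import Function.Bundles using (mk⇔)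

infix 4 _≤*_

_≤*_ : ∀ {n} → Word n → Word n → Set
_≤*_ = Pointwise _≤_

Increment : ∀ {n} → Word n → Word n → Set
Increment v w = Σ (Fin _) λ i → w ≡ v [ i ]≔ suc (lookup v i)

Increment-∷ : ∀ {n x} {v w : Word n} → Increment v w → Increment (x ∷ v) (x ∷ w)
Increment-∷ {x = x} (i , w≡v[i]) = suc i , cong (x ∷_) w≡v[i]

Increment⇒≤* : ∀ {n} {v w : Word n} → Increment v w → v ≤* w
Increment⇒≤* {v = x ∷ v} (zero , refl) = n≤1+n x ∷ Pointwise.refl ≤-refl
Increment⇒≤* {v = x ∷ v} (suc i , refl) = ≤-refl ∷ Increment⇒≤* (i , refl)

Le⇒≤* : ∀ {n k} {v w : Word n} → Le n k v w → v ≤* w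
Le⇒≤* = fold _≤*_ (λ (_ , _ , step) → Pointwise.trans ≤-trans (Increment⇒≤* step))
              (Pointwise.refl ≤-refl)

data SameRecords : ∀ {n} → ℕ → Word n → Word n → Set where
  [] : ∀ {m} → SameRecords m [] []
  same : ∀ {n m x} {xs ys : Word n} →
         SameRecords (m ⊔ x) xs ys → SameRecords m (x ∷ xs) (x ∷ ys)
  nonRecords : ∀ {n m x y} {xs ys : Word n} → x ≤ m → 1 ≤ y → y ≤ m →
               SameRecords (m ⊔ x) xs ys → SameRecords m (x ∷ xs) (y ∷ ys)

SameRecords-RGtail : ∀ {n m} {xs ys : Word n} → SameRecords m xs ys → RGtail m xs →
                     RGtail m ys × m ⊔ maxLetter ys ≡ m ⊔ maxLetter xs
SameRecords-∷ : ∀ {n m x y} {xs ys : Word n} → m ⊔ y ≡ m ⊔ x → 1 ≤ y → y ≤ suc m →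
                SameRecords (m ⊔ x) xs ys → RGtail (m ⊔ x) xs →
                RGtail m (y ∷ ys) × m ⊔ (y ⊔ maxLetter ys) ≡ m ⊔ (x ⊔ maxLetter xs)

SameRecords-RGtail [] _ = tt , refl
SameRecords-RGtail (same s) (1≤x , x≤1+m , rg) = SameRecords-∷ refl 1≤x x≤1+m s rg
SameRecords-RGtail {m = m} (nonRecords x≤m 1≤y y≤m s) (_ , _ , rg) =
  SameRecords-∷ (trans (m≥n⇒m⊔n≡m y≤m) (sym (m≥n⇒m⊔n≡m x≤m))) 1≤y (m≤n⇒m≤1+n y≤m) s rg

SameRecords-∷ {m = m} {x} {y} {xs} {ys} m⊔y≡m⊔x 1≤y y≤1+m s rg =
  let rg′ , max≡ = SameRecords-RGtail s rg in
  (1≤y , y≤1+m , subst (λ t → RGtail t ys) (sym m⊔y≡m⊔x) rg′) ,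
  (begin
    m ⊔ (y ⊔ maxLetter ys) ≡⟨ ⊔-assoc m y _ ⟨
    m ⊔ y ⊔ maxLetter ys   ≡⟨ cong (_⊔ maxLetter ys) m⊔y≡m⊔x ⟩
    m ⊔ x ⊔ maxLetter ys   ≡⟨ max≡ ⟩
    m ⊔ x ⊔ maxLetter xs   ≡⟨ ⊔-assoc m x _ ⟩
    m ⊔ (x ⊔ maxLetter xs) ∎)
  where open ≡-Reasoning

SameRecords-InR : ∀ {n k x} {xs ys : Word n} → SameRecords x xs ys →
                  InR (suc n) k (x ∷ xs) → InR (suc n) k (x ∷ ys)
SameRecords-InR s ((x≡1 , rg) , max≡k) =
  let rg′ , max≡ = SameRecords-RGtail s rg in (x≡1 , rg′) , trans max≡ max≡k

record BooleanParametrisation {n r} (f : Subset r → Word n) (lo hi : Word n) : Set where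
  field
    bottom   : f ⊥ ≡ lo
    top      : f ⊤ ≡ hi
    chain    : ∀ {S T} → S ⊆ T → Star (Increment on f) S T
    reflects : ∀ {S T} → f S ≤* f T → S ⊆ T
    onto     : ∀ {u} → lo ≤* u → u ≤* hi → ∃ λ S → f S ≡ u

consRaisable : ∀ {n r} (b : Bool) (x : ℕ) → (Subset r → Word n) →
               Subset ((if b then 1 else 0) + r) → Word (suc n)
consRaisable true  x f (s ∷ S) = (if s then suc x else x) ∷ f S
consRaisable false x f S       = x ∷ f S

module _ {n r} {f : Subset r → Word n} {lo hi : Word n} (P : BooleanParametrisation f lo hi) where
  open BooleanParametrisation P

  consRaisable-parametrisation : ∀ b x →
    BooleanParametrisation (consRaisable b x f) (x ∷ lo) ((if b then suc x else x) ∷ hi)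
  consRaisable-parametrisation true x = record
    { bottom   = cong (x ∷_) bottom
    ; top      = cong (suc x ∷_) top
    ; chain    = chain′
    ; reflects = reflects′
    ; onto     = onto′
    }
    where
      g = consRaisable true x f

      chain′ : ∀ {S T} → S ⊆ T → Star (Increment on g) S T
      chain′ {s ∷ S} {t ∷ T} sS⊆tT =
        gmap (s ∷_) Increment-∷ (chain (drop-∷-⊆ sS⊆tT)) ◅◅ flip s t sS⊆tT
        where
          flip : ∀ s t → s ∷ S ⊆ t ∷ T → Star (Increment on g) (s ∷ T) (t ∷ T)
          flip outside outside _ = ε
          flip inside  inside  _ = ε
          flip outside inside  _ = (zero , refl) ◅ ε
          flip inside  outside sS⊆tT with sS⊆tT here
          ... | ()

      reflects′ : ∀ {S T} → g S ≤* g T → S ⊆ T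
      reflects′ {T = inside  ∷ _} _            here        = here
      reflects′ {T = outside ∷ _} (x<x ∷ _)    here        = contradiction x<x (n≮n x)
      reflects′ {_ ∷ _} {_ ∷ _}    (_ ∷ ≤s)    (there i∈S) = there (reflects ≤s i∈S)

      onto′ : ∀ {u} → x ∷ lo ≤* u → u ≤* suc x ∷ hi → ∃ λ S → g S ≡ u
      onto′ {u ∷ us} (x≤u ∷ lo≤us) (u≤1+x ∷ us≤hi) with onto lo≤us us≤hi | x ≟ u
      ... | S , fS≡us | yes refl = outside ∷ S , cong (x ∷_) fS≡us
      ... | S , fS≡us | no x≢u   = inside ∷ S , cong₂ _∷_ (≤-antisym (≤∧≢⇒< x≤u x≢u) u≤1+x) fS≡us
  consRaisable-parametrisation false x = record
    { bottom   = cong (x ∷_) bottom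
    ; top      = cong (x ∷_) top
    ; chain    = gmap id Increment-∷ ∘ chain
    ; reflects = λ { (_ ∷ ≤s) → reflects ≤s }
    ; onto     = λ { (x≤u ∷ lo≤us) (u≤x ∷ us≤hi) →
                     let S , fS≡us = onto lo≤us us≤hi in S , cong₂ _∷_ (≤-antisym x≤u u≤x) fS≡us }
    }

-- Subset (Btail m xs) is read as a set of inversion positions of xs (letters
-- below the running maximum, the positions counted by Btail), left to right.
raiseTail : ∀ {n} (m : ℕ) (xs : Word n) → Subset (Btail m xs) → Word n
raiseTail m []       _ = []
raiseTail m (x ∷ xs)   = consRaisable (x <ᵇ m) x (raiseTail (m ⊔ x) xs)

raiseTail-parametrisation : ∀ {n} m (xs : Word n) →
                            BooleanParametrisation (raiseTail m xs) xs (αtail m xs)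
raiseTail-parametrisation m [] = record
  { bottom   = refl
  ; top      = refl
  ; chain    = λ { {[]} {[]} _ → ε }
  ; reflects = λ { {[]} _ () }
  ; onto     = λ { [] [] → [] , refl }
  }
raiseTail-parametrisation m (x ∷ xs) =
  consRaisable-parametrisation (raiseTail-parametrisation (m ⊔ x) xs) (x <ᵇ m) x

SameRecords-raiseTail : ∀ {n} m (xs : Word n) S → SameRecords m xs (raiseTail m xs S)
SameRecords-raiseTail m [] [] = []
SameRecords-raiseTail m (x ∷ xs) S with x <ᵇ m | <ᵇ-reflects-< x m
SameRecords-raiseTail m (x ∷ xs) (inside ∷ S)  | true | ofʸ x<m =
  nonRecords (<⇒≤ x<m) (s≤s z≤n) x<m (SameRecords-raiseTail (m ⊔ x) xs S)
SameRecords-raiseTail m (x ∷ xs) (outside ∷ S) | true  | _ =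
  same (SameRecords-raiseTail (m ⊔ x) xs S)
SameRecords-raiseTail m (x ∷ xs) S             | false | _ =
  same (SameRecords-raiseTail (m ⊔ x) xs S)

parity≡0ℙ⇒2∣ : ∀ a → parity a ≡ 0ℙ → 2 ∣ a
parity≡0ℙ⇒2∣ zero          _    = divides 0 refl
parity≡0ℙ⇒2∣ (suc (suc a)) even = ∣m∣n⇒∣m+n ∣-refl (parity≡0ℙ⇒2∣ a even)

2∣⇒parity≡0ℙ : ∀ {a} → 2 ∣ a → parity a ≡ 0ℙ
2∣⇒parity≡0ℙ (divides q refl) = trans (*-homo-* q 2) (ℙ.*-zeroʳ (parity q))

parity≡0ℙ⇒parity-pred≡1ℙ : ∀ {a} → 1 ≤ a → parity a ≡ 0ℙ → parity (pred a) ≡ 1ℙ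
parity≡0ℙ⇒parity-pred≡1ℙ {suc a} _ even = trans (sym (suc-homo-⁻¹ a)) (cong _⁻¹ even)

parity≡1ℙ⇒parity-suc≡0ℙ : ∀ {a} → parity a ≡ 1ℙ → parity (suc a) ≡ 0ℙ
parity≡1ℙ⇒parity-suc≡0ℙ {a} odd = sym (⁻¹-selfInverse (trans (suc-homo-⁻¹ a) odd))

NonRecordsOdd : ∀ {n} → ℕ → Word n → Set
NonRecordsOdd m []       = Unit.⊤
NonRecordsOdd m (x ∷ xs) = (x ≤ m → parity x ≡ 1ℙ) × NonRecordsOdd (m ⊔ x) xs

≡ᵇ-reflects-≡ : ∀ m n → Reflects (m ≡ n) (m ≡ᵇ n)
≡ᵇ-reflects-≡ m n = fromEquivalence (≡ᵇ⇒≡ m n) (≡⇒≡ᵇ m n)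

count-∷ : ∀ {n a} x (xs : Word n) → count (_≟ a) xs ≤ count (_≟ a) (x ∷ xs)
count-∷ {a = a} x xs with x ≡ᵇ a | ≡ᵇ-reflects-≡ x a
... | true  | _ = n≤1+n _
... | false | _ = ≤-refl

∈⇒count≥1 : ∀ {n a} {xs : Word n} → a ∈ xs → 1 ≤ count (_≟ a) xs
∈⇒count≥1 {a = a} {x ∷ xs} a∈xs with x ≡ᵇ a | ≡ᵇ-reflects-≡ x a | a∈xs
... | true  | _        | _          = s≤s z≤n
... | false | ofⁿ x≢a  | here a≡x   = contradiction (sym a≡x) x≢a
... | false | _        | there a∈xs = ∈⇒count≥1 a∈xs

count-even≡0 : ∀ {n m a} (xs : Word n) → NonRecordsOdd m xs → parity a ≡ 0ℙ → a ≤ m →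
               count (_≟ a) xs ≡ 0
count-even≡0 [] _ _ _ = refl
count-even≡0 {m = m} {a} (x ∷ xs) (odd , odds) even a≤m with x ≡ᵇ a | ≡ᵇ-reflects-≡ x a
... | true  | ofʸ refl = contradiction (trans (sym (odd a≤m)) even) λ ()
... | false | _        = count-even≡0 xs odds even (≤-trans a≤m (m≤m⊔n m x))

count-even≤1 : ∀ {n m a} (xs : Word n) → NonRecordsOdd m xs → parity a ≡ 0ℙ →
               count (_≟ a) xs ≤ 1
count-even≤1 [] _ _ = z≤n
count-even≤1 {m = m} {a} (x ∷ xs) (_ , odds) even with x ≡ᵇ a | ≡ᵇ-reflects-≡ x a
... | true  | ofʸ refl = s≤s (≤-reflexive (count-even≡0 xs odds even (m≤n⊔m m x)))
... | false | _        = count-even≤1 xs odds even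

NonRecordsOdd⇒InA : ∀ {n k x} {xs : Word n} → InR (suc n) k (x ∷ xs) → NonRecordsOdd x xs →
                    InA (suc n) k (x ∷ xs)
NonRecordsOdd⇒InA {xs = xs} w∈R@((refl , _) , _) odds = w∈R , once
  where
    once : ∀ a → 2 ∣ a → a ∈ 1 ∷ xs → count (_≟ a) (1 ∷ xs) ≡ 1
    once a 2∣a a∈w with 1 ≡ᵇ a | ≡ᵇ-reflects-≡ 1 a | a∈w
    ... | true  | ofʸ refl | _          = contradiction (∣1⇒≡1 2∣a) λ ()
    ... | false | ofⁿ 1≢a  | here a≡1   = contradiction (sym a≡1) 1≢a
    ... | false | _        | there a∈xs =
      ≤-antisym (count-even≤1 xs odds (2∣⇒parity≡0ℙ 2∣a)) (∈⇒count≥1 a∈xs)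

count-here : ∀ {n} x (xs : Word n) → count (_≟ x) (x ∷ xs) ≡ suc (count (_≟ x) xs)
count-here x xs with x ≡ᵇ x | ≡ᵇ-reflects-≡ x x
... | true  | _       = refl
... | false | ofⁿ x≢x = contradiction refl x≢x

RGtail-∈⇒≥1 : ∀ {n m a} {xs : Word n} → RGtail m xs → a ∈ xs → 1 ≤ a
RGtail-∈⇒≥1 (1≤x , _ , _)  (here refl)  = 1≤x
RGtail-∈⇒≥1 (_ , _ , rg)   (there a∈xs) = RGtail-∈⇒≥1 rg a∈xs

-- In an allowable RG word an even non-record would repeat an earlier record;
-- this invariant carries the uniqueness of even letters along the word.
EvenLettersFresh : ∀ {n} → ℕ → Word n → Set
EvenLettersFresh m xs = ∀ a → parity a ≡ 0ℙ → a ∈ xs → m < a × count (_≟ a) xs ≤ 1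

EvenLettersFresh⇒NonRecordsOdd : ∀ {n m} (xs : Word n) → RGtail m xs → EvenLettersFresh m xs →
                                 NonRecordsOdd m xs
EvenLettersFresh⇒NonRecordsOdd [] _ _ = tt
EvenLettersFresh⇒NonRecordsOdd {m = m} (x ∷ xs) (_ , x≤1+m , rg) fresh =
  odd , EvenLettersFresh⇒NonRecordsOdd xs rg fresh′
  where
    odd : x ≤ m → parity x ≡ 1ℙ
    odd x≤m with parity x in px
    ... | 0ℙ = contradiction x≤m (<⇒≱ (proj₁ (fresh x px (here refl))))
    ... | 1ℙ = refl

    fresh′ : EvenLettersFresh (m ⊔ x) xs
    fresh′ a even a∈xs = ⊔-lub m<a x<a , ≤-trans (count-∷ x xs) once
      where
        m<a = proj₁ (fresh a even (there a∈xs))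
        once = proj₂ (fresh a even (there a∈xs))
        x<a : x < a
        x<a with <-cmp x a
        ... | tri< x<a _ _ = x<a
        ... | tri≈ _ refl _ =
          contradiction (subst (_≤ 1) (count-here x xs) once) (<⇒≱ (s≤s (∈⇒count≥1 a∈xs)))
        ... | tri> _ _ a<x = contradiction m<a (≤⇒≯ (≤-pred (≤-trans a<x x≤1+m)))

InA⇒NonRecordsOdd : ∀ {n k x} {xs : Word n} → InA (suc n) k (x ∷ xs) → NonRecordsOdd x xs
InA⇒NonRecordsOdd {xs = xs} (((refl , rg) , _) , once) = EvenLettersFresh⇒NonRecordsOdd xs rg fresh
  where
    fresh : EvenLettersFresh 1 xs
    fresh a even a∈xs =
      ≤∧≢⇒< (RGtail-∈⇒≥1 rg a∈xs) (λ { refl → contradiction even λ () }) ,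
      ≤-trans (count-∷ 1 xs) (≤-reflexive (once a (parity≡0ℙ⇒2∣ a even) (there a∈xs)))

raiseLetter : ℕ → ℕ → ℕ
raiseLetter m x = if x <ᵇ m then suc x else x

lowerLetter : ℕ → ℕ → ℕ
lowerLetter m y with y ≤ᵇ m | parity y
... | true | 0ℙ = pred y
... | _    | _  = y

lowerLetter-odd : ∀ {m y} → (y ≤ m → parity y ≡ 1ℙ) → lowerLetter m y ≡ y
lowerLetter-odd {m} {y} odd with y ≤ᵇ m | ≤ᵇ-reflects-≤ y m | parity y
... | true  | ofʸ y≤m | 0ℙ = contradiction (odd y≤m) λ ()
... | true  | _       | 1ℙ = refl
... | false | _       | _  = refl

lowerLetter-even : ∀ {m y} → y ≤ m → parity y ≡ 0ℙ → lowerLetter m y ≡ pred y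
lowerLetter-even {m} {y} y≤m even with y ≤ᵇ m | ≤ᵇ-reflects-≤ y m | parity y
... | true  | _        | 0ℙ = refl
... | true  | _        | 1ℙ = contradiction even λ ()
... | false | ofⁿ y≰m  | _  = contradiction y≤m y≰m

lowerLetter-≤ : ∀ m y → lowerLetter m y ≤ y
lowerLetter-≤ m y with y ≤ᵇ m | parity y
... | true  | 0ℙ = pred[n]≤n
... | true  | 1ℙ = ≤-refl
... | false | _  = ≤-refl

lowerLetter-≥1 : ∀ m y → 1 ≤ y → 1 ≤ lowerLetter m y
lowerLetter-≥1 m 1             _ = ≤-reflexive (sym (lowerLetter-odd {m} λ _ → refl))
lowerLetter-≥1 m (suc (suc z)) _ with suc (suc z) ≤ᵇ m | parity z
... | true  | 0ℙ = s≤s z≤n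
... | true  | 1ℙ = s≤s z≤n
... | false | _  = s≤s z≤n

⊔-lowerLetter : ∀ m y → m ⊔ lowerLetter m y ≡ m ⊔ y
⊔-lowerLetter m y with y ≤ᵇ m | ≤ᵇ-reflects-≤ y m | parity y
... | true  | ofʸ y≤m | 0ℙ = trans (m≥n⇒m⊔n≡m (≤-trans pred[n]≤n y≤m)) (sym (m≥n⇒m⊔n≡m y≤m))
... | true  | _       | 1ℙ = refl
... | false | _       | _  = refl

lowerLetter-nonRecordOdd : ∀ {m y} → 1 ≤ y → lowerLetter m y ≤ m → parity (lowerLetter m y) ≡ 1ℙ
lowerLetter-nonRecordOdd {m} {y} 1≤y ≤m with y ≤ᵇ m | ≤ᵇ-reflects-≤ y m | parity y in py
... | true  | _        | 0ℙ = parity≡0ℙ⇒parity-pred≡1ℙ 1≤y py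
... | true  | _        | 1ℙ = py
... | false | ofⁿ y≰m  | _  = contradiction ≤m y≰m

raiseLetter-< : ∀ {m x} → x < m → raiseLetter m x ≡ suc x
raiseLetter-< {m} {x} x<m with x <ᵇ m | <ᵇ-reflects-< x m
... | true  | _        = refl
... | false | ofⁿ x≮m = contradiction x<m x≮m

≤-raiseLetter : ∀ m x → x ≤ raiseLetter m x
≤-raiseLetter m x with x <ᵇ m
... | true  = n≤1+n x
... | false = ≤-refl

≤-raiseLetter-lowerLetter : ∀ {m y} → 1 ≤ y → y ≤ raiseLetter m (lowerLetter m y)
≤-raiseLetter-lowerLetter {m} {suc z} _ with suc z ≤ᵇ m | ≤ᵇ-reflects-≤ (suc z) m | parity (suc z)
... | true  | ofʸ z<m | 0ℙ = ≤-reflexive (sym (raiseLetter-< z<m))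
... | true  | _       | 1ℙ = ≤-raiseLetter m (suc z)
... | false | _       | _  = ≤-raiseLetter m (suc z)

lowerLetter-between : ∀ {m x u} → (x ≤ m → parity x ≡ 1ℙ) → x ≤ u → u ≤ raiseLetter m x →
                      lowerLetter m u ≡ x
lowerLetter-between {m} {x} {u} odd x≤u u≤x′ with x <ᵇ m | <ᵇ-reflects-< x m | x ≟ u
... | _     | _        | yes refl = lowerLetter-odd odd
... | true  | ofʸ x<m  | no x≢u   rewrite ≤-antisym u≤x′ (≤∧≢⇒< x≤u x≢u) =
  lowerLetter-even x<m (parity≡1ℙ⇒parity-suc≡0ℙ {x} (odd (<⇒≤ x<m)))
... | false | _        | no x≢u   = contradiction (≤-antisym x≤u u≤x′) x≢u

lowerTail : ∀ {n} → ℕ → Word n → Word n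
lowerTail m []       = []
lowerTail m (y ∷ ys) = lowerLetter m y ∷ lowerTail (m ⊔ y) ys

SameRecords-lowerTail : ∀ {n m} (ys : Word n) → RGtail m ys → SameRecords m ys (lowerTail m ys)
SameRecords-lowerTail [] _ = []
SameRecords-lowerTail {m = m} (y ∷ ys) (1≤y , _ , rg) with y ≤? m
... | yes y≤m = nonRecords y≤m (lowerLetter-≥1 m y 1≤y) (≤-trans (lowerLetter-≤ m y) y≤m)
                  (SameRecords-lowerTail ys rg)
... | no  y≰m rewrite lowerLetter-odd {m} {y} (λ y≤m → contradiction y≤m y≰m) =
  same (SameRecords-lowerTail ys rg)

NonRecordsOdd-lowerTail : ∀ {n m} (ys : Word n) → RGtail m ys → NonRecordsOdd m (lowerTail m ys)
NonRecordsOdd-lowerTail [] _ = tt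
NonRecordsOdd-lowerTail {m = m} (y ∷ ys) (1≤y , _ , rg) rewrite ⊔-lowerLetter m y =
  lowerLetter-nonRecordOdd 1≤y , NonRecordsOdd-lowerTail ys rg

lowerTail-≤* : ∀ {n} m (ys : Word n) → lowerTail m ys ≤* ys
lowerTail-≤* m []       = []
lowerTail-≤* m (y ∷ ys) = lowerLetter-≤ m y ∷ lowerTail-≤* (m ⊔ y) ys

≤*-αtail-lowerTail : ∀ {n m} (ys : Word n) → RGtail m ys → ys ≤* αtail m (lowerTail m ys)
≤*-αtail-lowerTail [] _ = []
≤*-αtail-lowerTail {m = m} (y ∷ ys) (1≤y , _ , rg) rewrite ⊔-lowerLetter m y =
  ≤-raiseLetter-lowerLetter 1≤y ∷ ≤*-αtail-lowerTail ys rg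

lowerTail-between : ∀ {n m} {xs us : Word n} → NonRecordsOdd m xs → xs ≤* us → us ≤* αtail m xs →
                    lowerTail m us ≡ xs
lowerTail-between {xs = []} {[]} _ [] [] = refl
lowerTail-between {m = m} {x ∷ xs} {u ∷ us} (odd , odds) (x≤u ∷ xs≤us) (u≤x′ ∷ us≤xs′) =
  cong₂ _∷_ lower≡x
    (trans (cong (λ t → lowerTail t us) m⊔u≡m⊔x) (lowerTail-between odds xs≤us us≤xs′))
  where
    lower≡x = lowerLetter-between odd x≤u u≤x′
    m⊔u≡m⊔x = trans (sym (⊔-lowerLetter m u)) (cong (m ⊔_) lower≡x)

letter+C2 : ∀ {m x} → 1 ≤ x → x ≤ suc m →
            x + m C 2 ≡ suc ((if x ≤ᵇ m then x ∸ 1 else 0) + (m ⊔ x) C 2)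
letter+C2 {m} {suc x} _ x<1+m with suc x ≤ᵇ m | ≤ᵇ-reflects-≤ (suc x) m
... | true  | ofʸ x<m  rewrite m≥n⇒m⊔n≡m x<m = refl
... | false | ofⁿ x≮m rewrite ≤-antisym (≤-pred x<1+m) (≮⇒≥ x≮m) | m≤n⇒m⊔n≡n (n≤1+n m) =
  cong suc (trans (cong (_+ m C 2) (sym (nC1≡n m))) (nCk+nC[k+1]≡[n+1]C[k+1] m 1))

sumW-RGtail : ∀ {n m} (xs : Word n) → RGtail m xs →
              sumW xs + m C 2 ≡ n + (Atail m xs + (m ⊔ maxLetter xs) C 2)
sumW-RGtail {m = m} [] _ rewrite ⊔-identityʳ m = refl
sumW-RGtail {suc n} {m} (x ∷ xs) (1≤x , x≤1+m , rg) =
  begin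
    x + sumW xs + m C 2                  ≡⟨ xy∙z≈y∙xz x (sumW xs) _ ⟩
    sumW xs + (x + m C 2)                ≡⟨ cong (sumW xs +_) (letter+C2 1≤x x≤1+m) ⟩
    sumW xs + suc (a + (m ⊔ x) C 2)      ≡⟨ +-suc (sumW xs) _ ⟩
    suc (sumW xs + (a + (m ⊔ x) C 2))    ≡⟨ cong suc (x∙yz≈y∙xz (sumW xs) a _) ⟩
    suc (a + (sumW xs + (m ⊔ x) C 2))    ≡⟨ cong (λ t → suc (a + t)) (sumW-RGtail xs rg) ⟩
    suc (a + (n + (A + (m ⊔ x ⊔ M) C 2))) ≡⟨ cong suc (x∙yz≈y∙xz a n _) ⟩
    suc (n + (a + (A + (m ⊔ x ⊔ M) C 2))) ≡⟨ cong (λ t → suc (n + t)) (+-assoc a A _) ⟨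
    suc (n + (a + A + (m ⊔ x ⊔ M) C 2))   ≡⟨ cong (λ t → suc (n + (a + A + t C 2)))
                                                  (⊔-assoc m x M) ⟩
    suc (n + (a + A + (m ⊔ (x ⊔ M)) C 2)) ∎
  where
    open ≡-Reasoning
    a = if x ≤ᵇ m then x ∸ 1 else 0
    A = Atail (m ⊔ x) xs
    M = maxLetter xs

rank≡Astat : ∀ {n k} (w : Word n) → InR n k w → rank n k w ≡ Astat w
rank≡Astat {suc n} {k} (1 ∷ xs) ((refl , rg) , refl) =
  begin
    sumW xs ∸ n ∸ k C 2                 ≡⟨ cong (λ s → s ∸ n ∸ k C 2) sum≡ ⟩
    n + (Atail 1 xs + k C 2) ∸ n ∸ k C 2 ≡⟨ cong (_∸ k C 2) (m+n∸m≡n n _) ⟩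
    Atail 1 xs + k C 2 ∸ k C 2          ≡⟨ m+n∸n≡m (Atail 1 xs) (k C 2) ⟩
    Atail 1 xs                          ∎
  where
    open ≡-Reasoning
    sum≡ : sumW xs ≡ n + (Atail 1 xs + k C 2)
    sum≡ = trans (sym (+-identityʳ (sumW xs))) (sumW-RGtail xs rg)

qcoeff-below : ∀ i j {m} → m < i → qcoeff i j m ≡ 0
qcoeff-below i j {m} m<i with m <ᵇ i | <ᵇ-reflects-< m i
... | true  | _        = refl
... | false | ofⁿ m≮i = contradiction m<i m≮i

qcoeff-above : ∀ i j {m} → i ≤ m → qcoeff i j m ≡ j C (m ∸ i)
qcoeff-above i j {m} i≤m with m <ᵇ i | <ᵇ-reflects-< m i
... | true  | ofʸ m<i = contradiction i≤m (<⇒≱ m<i)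
... | false | _       = refl

qcoeff-lowest≤ : ∀ {a b i j} → (∀ m → qcoeff a b m ≡ qcoeff i j m) → i ≤ a
qcoeff-lowest≤ {a} {b} {i} {j} coeffs≡ = ≮⇒≥ λ a<i → contradiction (begin
  1            ≡⟨ cong (b C_) (n∸n≡0 a) ⟨
  b C (a ∸ a)  ≡⟨ qcoeff-above a b ≤-refl ⟨
  qcoeff a b a ≡⟨ coeffs≡ a ⟩
  qcoeff i j a ≡⟨ qcoeff-below i j a<i ⟩
  0            ∎) λ ()
  where open ≡-Reasoning

qcoeff-degree≤ : ∀ {a b j} → (∀ m → qcoeff a b m ≡ qcoeff a j m) → b ≤ j
qcoeff-degree≤ {a} {b} {j} coeffs≡ = ≮⇒≥ λ j<b → contradiction (begin
  1                  ≡⟨ nCn≡1 b ⟨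
  b C b              ≡⟨ cong (b C_) (m+n∸m≡n a b) ⟨
  b C (a + b ∸ a)    ≡⟨ qcoeff-above a b (m≤m+n a b) ⟨
  qcoeff a b (a + b) ≡⟨ coeffs≡ (a + b) ⟩
  qcoeff a j (a + b) ≡⟨ qcoeff-above a j (m≤m+n a b) ⟩
  j C (a + b ∸ a)    ≡⟨ cong (j C_) (m+n∸m≡n a b) ⟩
  j C b              ≡⟨ k>n⇒nCk≡0 j<b ⟩
  0                  ∎) λ ()
  where open ≡-Reasoning

qcoeff-injective : ∀ {a b i j} → (∀ m → qcoeff a b m ≡ qcoeff i j m) → a ≡ i × b ≡ j
qcoeff-injective {a} {b} {i} {j} coeffs≡
  with ≤-antisym (qcoeff-lowest≤ {i} {j} {a} {b} (sym ∘ coeffs≡)) (qcoeff-lowest≤ coeffs≡)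
... | refl =
  refl , ≤-antisym (qcoeff-degree≤ {a} coeffs≡) (qcoeff-degree≤ {a} {j} {b} (sym ∘ coeffs≡))

lower : ∀ {n} → Word n → Word n
lower []       = []
lower (y ∷ us) = y ∷ lowerTail y us

lower-InA : ∀ {n k} {u : Word n} → InR n k u → InA n k (lower u)
lower-InA {u = y ∷ us} u∈R@((_ , rg) , _) =
  NonRecordsOdd⇒InA (SameRecords-InR (SameRecords-lowerTail us rg) u∈R)
                    (NonRecordsOdd-lowerTail us rg)

lower-≤* : ∀ {n} (u : Word n) → lower u ≤* u
lower-≤* []       = []
lower-≤* (y ∷ us) = ≤-refl ∷ lowerTail-≤* y us

≤*-α-lower : ∀ {n k} {u : Word n} → InR n k u → u ≤* α (lower u)
≤*-α-lower {u = y ∷ us} ((_ , rg) , _) = ≤-refl ∷ ≤*-αtail-lowerTail us rg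

InA-interval⇒≡lower : ∀ {n k} {w u : Word n} → InA n k w → InInterval n k w u → w ≡ lower u
InA-interval⇒≡lower {w = x ∷ xs} {y ∷ us} w∈A (_ , w≤u , u≤αw)
  with Le⇒≤* w≤u | Le⇒≤* u≤αw
... | x≤y ∷ xs≤us | y≤x ∷ us≤αxs with ≤-antisym x≤y y≤x
... | refl = cong (x ∷_) (sym (lowerTail-between (InA⇒NonRecordsOdd w∈A) xs≤us us≤αxs))

module _ {n k x} {xs : Word n} (w∈R : InR (suc n) k (x ∷ xs)) where
  private
    w = x ∷ xs
    open BooleanParametrisation (raiseTail-parametrisation x xs)

  raise : Subset (Bstat w) → Word (suc n)
  raise S = x ∷ raiseTail x xs S

  raise-InR : ∀ S → InR (suc n) k (raise S)
  raise-InR S = SameRecords-InR (SameRecords-raiseTail x xs S) w∈R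

  raise-Le : ∀ {S T} → S ⊆ T → Le (suc n) k (raise S) (raise T)
  raise-Le S⊆T =
    gmap raise (λ {S} {T} step → raise-InR S , raise-InR T , Increment-∷ step) (chain S⊆T)

  raise-reflects-≤* : ∀ {S T} → raise S ≤* raise T → S ⊆ T
  raise-reflects-≤* (_ ∷ ≤s) = reflects ≤s

  Le-raise : ∀ S → Le (suc n) k w (raise S)
  Le-raise S = subst (λ v → Le (suc n) k v (raise S)) (cong (x ∷_) bottom) (raise-Le ⊥⊆)

  raise-Le-α : ∀ S → Le (suc n) k (raise S) (α w)
  raise-Le-α S = subst (Le (suc n) k (raise S)) (cong (x ∷_) top) (raise-Le ⊆⊤)

  α-InR : InR (suc n) k (α w)
  α-InR = subst (InR (suc n) k) (cong (x ∷_) top) (raise-InR ⊤)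

  Le-α : Le (suc n) k w (α w)
  Le-α = subst (Le (suc n) k w) (cong (x ∷_) top) (Le-raise ⊤)

  ≤*⇒≡raise : ∀ {u} → w ≤* u → u ≤* α w → ∃ λ S → raise S ≡ u
  ≤*⇒≡raise {y ∷ us} (x≤y ∷ xs≤us) (y≤x ∷ us≤αxs) =
    let S , raiseS≡us = onto xs≤us us≤αxs in S , cong₂ _∷_ (≤-antisym x≤y y≤x) raiseS≡us

  ≤*⇒interval : ∀ {u} → w ≤* u → u ≤* α w → Le (suc n) k w u × Le (suc n) k u (α w)
  ≤*⇒interval w≤u u≤αw with ≤*⇒≡raise w≤u u≤αw
  ... | S , refl = Le-raise S , raise-Le-α S

  BooleanInterval-α : BooleanInterval (suc n) k w (α w) (Bstat w)
  BooleanInterval-α =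
    raise ,
    (λ S → raise-InR S , Le-raise S , raise-Le-α S) ,
    (λ u _ w≤u u≤αw → ≤*⇒≡raise (Le⇒≤* w≤u) (Le⇒≤* u≤αw)) ,
    (λ S T raiseS≡raiseT → ⊆-antisym (raise-reflects-≤* (≤*-reflexive raiseS≡raiseT))
                                     (raise-reflects-≤* (≤*-reflexive (sym raiseS≡raiseT)))) ,
    (λ S T → mk⇔ (raise-reflects-≤* ∘ Le⇒≤*) raise-Le)
    where
      ≤*-reflexive : ∀ {u v : Word (suc n)} → u ≡ v → u ≤* v
      ≤*-reflexive refl = Pointwise.refl ≤-refl

theorem5p1 : (n k : ℕ) → 1 ≤ n → 1 ≤ k → k ≤ n →
    (∀ w → InA n k w → InR n k (α w) × Le n k w (α w))
  × (∀ u → InR n k u → ∃ λ w → InA n k w × InInterval n k w u)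
  × (∀ w w′ u → InA n k w → InA n k w′ → InInterval n k w u → InInterval n k w′ u → w ≡ w′)
  × (∀ w i j → InA n k w →
       (∀ m → qcoeff (Astat w) (Bstat w) m ≡ qcoeff i j m) →
       (rank n k w ≡ i) × BooleanInterval n k w (α w) j)
theorem5p1 n k _ _ _ = α-upper , covered , disjoint , boolean
  where
    α-upper : ∀ w → InA n k w → InR n k (α w) × Le n k w (α w)
    α-upper (_ ∷ _) (w∈R , _) = α-InR w∈R , Le-α w∈R

    covered : ∀ u → InR n k u → ∃ λ w → InA n k w × InInterval n k w u
    covered u@(_ ∷ _) u∈R =
      lower u , lower-InA u∈R , u∈R ,
      ≤*⇒interval (proj₁ (lower-InA u∈R)) (lower-≤* u) (≤*-α-lower u∈R)

    disjoint : ∀ w w′ u → InA n k w → InA n k w′ → InInterval n k w u → InInterval n k w′ u → w ≡ w′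
    disjoint w w′ u w∈A w′∈A u∈[w] u∈[w′] =
      trans (InA-interval⇒≡lower w∈A u∈[w]) (sym (InA-interval⇒≡lower w′∈A u∈[w′]))

    boolean : ∀ w i j → InA n k w → (∀ m → qcoeff (Astat w) (Bstat w) m ≡ qcoeff i j m) →
              (rank n k w ≡ i) × BooleanInterval n k w (α w) j
    boolean w@(_ ∷ _) i j (w∈R , _) coeffs≡ =
      let A≡i , B≡j = qcoeff-injective coeffs≡
      in trans (rank≡Astat w w∈R) A≡i ,
         subst (BooleanInterval n k w (α w)) B≡j (BooleanInterval-α w∈R)
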